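{- Let $n\ge 1$ and let $K_{1,n}$ be the star with $n$ leaves. Then: (i) The graph $I_n(K_{1,n})$ is bipartite with parts $X$ and $Y$, where $X$ is the set of independent sets of $K_{1,n}$ of even cardinality and $Y$ is the set of independent sets of odd cardinality, and $|X|=2^{n-1}$, $|Y|=2^{n-1}+1$. (ii) The graph $I_n(K_{1,n})$ is not Hamiltonian.
   Context: For a simple graph $G=(V,E)$, a set $I\subseteq V$ is independent if no two of its vertices are adjacent; the empty set is independent (and has even cardinality). For a non-negative integer $k$, the $k$-independent graph $I_k(G)$ is the graph whose vertices are the independent sets of $G$ (including $\emptyset$) of cardinality at most $k$, two such sets being adjacent if and only if one is obtained from the other by adding or deleting a single vertex of $G$. -}

module Defs where

open import Level using (0ℓ)
open import Data.Nat using (ℕ; zero; suc; _≤_; _^_; _+_; _∸_)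
open import Data.Nat.Divisibility using (_∣_)
open import Data.Fin using (Fin; zero; suc; inject₁; fromℕ)
open import Data.Fin.Subset using (Subset; _∈_; _∉_; _∪_; ⁅_⁆; ∣_∣)
open import Data.Product using (Σ; _×_; _,_; proj₁; ∃; ∃-syntax)
open import Data.Sum using (_⊎_)
open import Data.Irrelevant using (Irrelevant)
open import Relation.Nullary using (¬_)
open import Relation.Binary.PropositionalEquality using (_≡_; _≢_)
open import Function.Definitions using (Bijective)

record SimpleGraph (m : ℕ) : Set₁ where
  field
    Adj     : Fin m → Fin m → Set
    sym     : ∀ {i j} → Adj i j → Adj j i
    irrefl  : ∀ {i} → ¬ Adj i i
open SimpleGraph public

-- The star K_{1,n}: vertex set Fin (suc n), centre = zero, leaves = suc i.
Star : (n : ℕ) → SimpleGraph (suc n)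
Star n = record
  { Adj    = λ i j → (i ≡ zero × j ≢ zero) ⊎ (j ≡ zero × i ≢ zero)
  ; sym    = λ { (Data.Sum.inj₁ (a , b)) → Data.Sum.inj₂ (a , b)
               ; (Data.Sum.inj₂ (a , b)) → Data.Sum.inj₁ (a , b) }
  ; irrefl = λ { (Data.Sum.inj₁ (a , b)) → b a
               ; (Data.Sum.inj₂ (a , b)) → b a } }

Independent : ∀ {m} → SimpleGraph m → Subset m → Set
Independent G S = ∀ i j → i ∈ S → j ∈ S → ¬ Adj G i j

-- Vertices of the k-independent graph I_k(G): independent sets of size ≤ k
-- (the proof component is irrelevant, so equality is equality of subsets).
IVertex : ∀ {m} → SimpleGraph m → ℕ → Set
IVertex {m} G k = Σ (Subset m) (λ S → Irrelevant (Independent G S × ∣ S ∣ ≤ k))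

AddsOne : ∀ {m} → Subset m → Subset m → Set
AddsOne {m} S T = ∃[ v ] (v ∉ S × T ≡ S ∪ ⁅ v ⁆)

IAdj : ∀ {m} (G : SimpleGraph m) (k : ℕ) → IVertex G k → IVertex G k → Set
IAdj G k A B = AddsOne (proj₁ A) (proj₁ B) ⊎ AddsOne (proj₁ B) (proj₁ A)

Even : ℕ → Set
Even n = 2 ∣ n

Odd : ℕ → Set
Odd n = ¬ (2 ∣ n)

XPart : ∀ {m} (G : SimpleGraph m) (k : ℕ) → Set
XPart G k = Σ (IVertex G k) (λ A → Irrelevant (Even ∣ proj₁ A ∣))

YPart : ∀ {m} (G : SimpleGraph m) (k : ℕ) → Set
YPart G k = Σ (IVertex G k) (λ A → Irrelevant (Odd ∣ proj₁ A ∣))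

BipartiteWithParts : {V : Set} → (V → V → Set) → (V → Set) → (V → Set) → Set
BipartiteWithParts {V} E P Q =
  (∀ v → P v ⊎ Q v) × (∀ v → P v → Q v → Data.Empty.⊥) ×
  (∀ u v → E u v → (P u × Q v) ⊎ (Q u × P v))
  where import Data.Empty

-- Hamiltonian: there is a cycle of length suc L ≥ 3 through every
-- vertex exactly once: a bijection f from Fin (suc L) (L ≥ 2) onto V with
-- consecutive entries adjacent, including the last and the first.
Hamiltonian : {V : Set} → (V → V → Set) → Set
Hamiltonian {V} E =
  ∃[ L ] (2 ≤ L × Σ (Fin (suc L) → V) λ f →
    Bijective _≡_ _≡_ f ×
    (∀ (i : Fin L) → E (f (inject₁ i)) (f (suc i))) ×
    E (f (fromℕ L)) (f zero))

-- The independent sets of the star are {c} and the sets of leaves. Fixing the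
-- parity, a set of leaves is determined by which of the leaves other than the
-- first it contains, so there are 2^(n-1) of each parity, and {c} is one extra
-- odd set. Adding or deleting a vertex changes the cardinality by one, which
-- gives the bipartition. Finally {c} has ∅ as its only neighbour (adding a
-- leaf to it breaks independence), so it lies on no cycle of length ≥ 3.
module Submission where

open import Defs hiding (sym)
open import Data.Bool using (Bool; true; false)
import Data.Bool.Properties as Bool
open import Data.Empty using (⊥-elim; ⊥-elim-irr) renaming (⊥ to Empty)
open import Data.Fin using (Fin; zero; suc; inject₁; fromℕ)
open import Data.Fin.Properties using (suc-injective; 1↔⊤; 2↔Bool; +↔⊎; *↔×)
open import Data.Fin.Relation.Unary.Top using (view; ‵fromℕ; ‵inject₁)
open import Data.Fin.Subset using (Subset; _∈_; _∉_; _∪_; ⁅_⁆; ∣_∣; ⊥; inside; outside)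
open import Data.Fin.Subset.Properties
  using (x∈⁅x⁆; x∈⁅y⁆⇒x≡y; x∉⁅y⁆⇒x≢y; ∣⁅x⁆∣≡1; ∣⊥∣≡0; ∣p∣≤n; Empty-unique; ∪-identityʳ; p⊆p∪q; q⊆p∪q)
open import Data.Irrelevant using (Irrelevant; [_])
open import Data.Nat using (ℕ; suc; _≤_; _^_; _+_; _∸_; z≤n; s≤s)
open import Data.Nat.Divisibility using (_∣_; divides; _∣?_; ∣m+n∣m⇒∣n; ∣1⇒≡1)
open import Data.Nat.Properties using (+-comm)
open import Data.Product using (Σ; ∃₂; _×_; _,_; proj₁; proj₂) renaming (swap to ×-swap)
open import Data.Product.Function.NonDependent.Propositional using (_×-↔_)
open import Data.Sum using (_⊎_; inj₁; inj₂; swap) renaming (map to ⊎-map)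
open import Data.Sum.Function.Propositional using (_⊎-↔_)
open import Data.Unit using (⊤; tt)
open import Data.Vec using (Vec; []; _∷_; here; there)
open import Data.Vec.Properties using (≡-dec)
open import Function.Bundles using (_↔_; mk↔ₛ′)
open import Function.Properties.Inverse using (↔-sym; ↔-trans)
open import Level using (Level)
open import Relation.Nullary using (¬_; yes; no; recompute)
open import Relation.Binary.PropositionalEquality using (_≡_; _≢_; refl; sym; trans; cong; subst)

private
  variable
    a p : Level
    A : Set a
    k m n : ℕ

Σ-irrelevant-≡ : {P : A → Set p} {x y : Σ A (λ z → Irrelevant (P z))} →
                 proj₁ x ≡ proj₁ y → x ≡ y
Σ-irrelevant-≡ {x = _ , _} {y = _ , _} refl = refl

Vec↔Fin^ : A ↔ Fin m → Vec A k ↔ Fin (m ^ k)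
Vec↔Fin^ {k = 0}     _     =
  mk↔ₛ′ (λ _ → zero) (λ _ → []) (λ { zero → refl ; (suc ()) }) (λ { [] → refl })
Vec↔Fin^ {k = suc k} A↔Fin = ↔-trans Vec-∷-↔ (↔-trans (A↔Fin ×-↔ Vec↔Fin^ A↔Fin) (↔-sym *↔×))
  where
  Vec-∷-↔ : Vec A (suc k) ↔ (A × Vec A k)
  Vec-∷-↔ = mk↔ₛ′ (λ { (x ∷ xs) → x , xs }) (λ { (x , xs) → x ∷ xs }) (λ _ → refl) (λ { (_ ∷ _) → refl })

Subset↔Fin2^ : Subset k ↔ Fin (2 ^ k)
Subset↔Fin2^ = Vec↔Fin^ (↔-sym 2↔Bool)

even-or-even-suc : ∀ n → Even n ⊎ Even (suc n)
even-or-even-suc 0       = inj₁ (divides 0 refl)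
even-or-even-suc (suc n) with even-or-even-suc n
... | inj₁ (divides q n≡q*2) = inj₂ (divides (suc q) (cong (λ z → suc (suc z)) n≡q*2))
... | inj₂ even-suc-n        = inj₁ even-suc-n

even⇒odd-suc : Even n → Odd (suc n)
even⇒odd-suc {n} even-n even-suc-n with ∣1⇒≡1 (∣m+n∣m⇒∣n (subst (2 ∣_) (+-comm 1 n) even-suc-n) even-n)
... | ()

odd⇒even-suc : Odd n → Even (suc n)
odd⇒even-suc {n} odd-n with even-or-even-suc n
... | inj₁ even-n     = ⊥-elim (odd-n even-n)
... | inj₂ even-suc-n = even-suc-n

odd-one : Odd 1
odd-one = even⇒odd-suc (divides 0 refl)

even-or-odd : ∀ n → Even n ⊎ Odd n
even-or-odd n with 2 ∣? n
... | yes even-n = inj₁ even-n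
... | no  odd-n  = inj₂ odd-n

odd-or-odd-suc : ∀ n → Odd n ⊎ Odd (suc n)
odd-or-odd-suc n with even-or-even-suc n
... | inj₁ even-n     = inj₂ (even⇒odd-suc even-n)
... | inj₂ even-suc-n = inj₁ (λ even-n → even⇒odd-suc even-n even-suc-n)

record Alternating (P : ℕ → Set) : Set where
  field
    holds-here-or-next : ∀ n → P n ⊎ P (suc n)
    not-here-and-next  : ∀ n → P n → P (suc n) → Empty

even-alternating : Alternating Even
even-alternating = record
  { holds-here-or-next = even-or-even-suc
  ; not-here-and-next  = λ _ → even⇒odd-suc }

odd-alternating : Alternating Odd
odd-alternating = record
  { holds-here-or-next = odd-or-odd-suc
  ; not-here-and-next  = λ n odd-n odd-suc-n → odd-suc-n (odd⇒even-suc odd-n) }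

SubsetsWith : (ℕ → Set) → ℕ → Set
SubsetsWith P n = Σ (Subset n) (λ T → Irrelevant (P ∣ T ∣))

module _ {P : ℕ → Set} (alternating : Alternating P) where
  open Alternating alternating

  completion : (U : Subset k) → Σ Bool (λ t → P ∣ t ∷ U ∣)
  completion U with holds-here-or-next ∣ U ∣
  ... | inj₁ P∣U∣   = false , P∣U∣
  ... | inj₂ P1+∣U∣ = true , P1+∣U∣

  completion-unique : ∀ {s t} {U : Subset k} → P ∣ s ∷ U ∣ → P ∣ t ∷ U ∣ → s ≡ t
  completion-unique {s = false} {false} _ _ = refl
  completion-unique {s = false} {true}  P∣U∣ P1+∣U∣ = ⊥-elim (not-here-and-next _ P∣U∣ P1+∣U∣)
  completion-unique {s = true}  {false} P1+∣U∣ P∣U∣ = ⊥-elim (not-here-and-next _ P∣U∣ P1+∣U∣)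
  completion-unique {s = true}  {true}  _ _ = refl

  SubsetsWith-suc↔Subset : SubsetsWith P (suc k) ↔ Subset k
  SubsetsWith-suc↔Subset = mk↔ₛ′ drop-first complete (λ _ → refl) complete∘drop-first
    where
    drop-first : SubsetsWith P (suc k) → Subset k
    drop-first (_ ∷ U , _) = U

    complete : Subset k → SubsetsWith P (suc k)
    complete U = proj₁ (completion U) ∷ U , [ proj₂ (completion U) ]

    complete∘drop-first : ∀ T → complete (drop-first T) ≡ T
    complete∘drop-first (t ∷ U , [ P∣T∣ ]) = Σ-irrelevant-≡ (cong (_∷ U)
      (recompute (proj₁ (completion U) Bool.≟ t)
        (completion-unique {t = t} {U = U} (proj₂ (completion U)) P∣T∣)))

leaves-independent : (T : Subset n) → Independent (Star n) (outside ∷ T)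
leaves-independent T _ _ () _ (inj₁ (refl , _))
leaves-independent T _ _ _ () (inj₂ (refl , _))

centre-independent : Independent (Star n) ⁅ zero ⁆
centre-independent {n} i j i∈ j∈ with x∈⁅y⁆⇒x≡y zero i∈ | x∈⁅y⁆⇒x≡y zero j∈
... | refl | refl = irrefl (Star n)

independent-with-centre : {T : Subset n} → Independent (Star n) (inside ∷ T) → T ≡ ⊥
independent-with-centre independent =
  Empty-unique (λ (i , i∈T) → independent zero (suc i) here (there i∈T) (inj₁ (refl , λ ())))

even-independent⇒centre-absent : ∀ {b} {T : Subset n} →
  Independent (Star n) (b ∷ T) → Even ∣ b ∷ T ∣ → b ≡ false
even-independent⇒centre-absent {b = false} _ _ = refl
even-independent⇒centre-absent {n} {b = true} independent even
  rewrite independent-with-centre independent =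
    ⊥-elim (odd-one (subst Even (cong suc (∣⊥∣≡0 n)) even))

centre-not-extendable : {T : Subset (suc n)} → Independent (Star n) T → ¬ AddsOne ⁅ zero ⁆ T
centre-not-extendable independent (v , v∉⁅zero⁆ , refl) =
  independent zero v (p⊆p∪q ⁅ v ⁆ (x∈⁅x⁆ zero)) (q⊆p∪q ⁅ zero ⁆ ⁅ v ⁆ (x∈⁅x⁆ v))
    (inj₁ (refl , x∉⁅y⁆⇒x≢y v∉⁅zero⁆))

removal-from-singleton : {S : Subset n} {x : Fin n} → AddsOne S ⁅ x ⁆ → S ≡ ⊥
removal-from-singleton {S = S} {x} (v , v∉S , ⁅x⁆≡S∪⁅v⁆) =
  Empty-unique λ (y , y∈S) →
    v∉S (subst (_∈ S) (trans (≡x (p⊆p∪q ⁅ v ⁆ y∈S)) (sym (≡x (q⊆p∪q S ⁅ v ⁆ (x∈⁅x⁆ v))))) y∈S)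
  where
  ≡x : ∀ {y} → y ∈ S ∪ ⁅ v ⁆ → y ≡ x
  ≡x y∈ = x∈⁅y⁆⇒x≡y x (subst (_ ∈_) (sym ⁅x⁆≡S∪⁅v⁆) y∈)

leaf-vertex : Subset n → IVertex (Star n) n
leaf-vertex T = outside ∷ T , [ leaves-independent T , ∣p∣≤n T ]

centre-vertex : IVertex (Star n) (suc k)
centre-vertex {n} {k} =
  ⁅ zero ⁆ , [ centre-independent , subst (_≤ suc k) (sym (∣⁅x⁆∣≡1 {suc n} zero)) (s≤s z≤n) ]

XPart↔even-leaf-sets : XPart (Star n) n ↔ SubsetsWith Even n
XPart↔even-leaf-sets = mk↔ₛ′ to from (λ _ → refl) from∘to
  where
  to : XPart (Star n) n → SubsetsWith Even n
  to ((b ∷ T , [ independent∧small ]) , [ even ]) =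
    T , [ subst (λ b → Even ∣ b ∷ T ∣)
                (even-independent⇒centre-absent (proj₁ independent∧small) even) even ]

  from : SubsetsWith Even n → XPart (Star n) n
  from (T , [ even ]) = leaf-vertex T , [ even ]

  from∘to : ∀ A → from (to A) ≡ A
  from∘to ((b ∷ T , [ independent∧small ]) , [ even ]) =
    Σ-irrelevant-≡ (Σ-irrelevant-≡ (cong (_∷ T) (sym (recompute (b Bool.≟ false)
      (even-independent⇒centre-absent (proj₁ independent∧small) even)))))

YPart↔odd-leaf-sets⊎⊤ : YPart (Star (suc n)) (suc n) ↔ (SubsetsWith Odd (suc n) ⊎ ⊤)
YPart↔odd-leaf-sets⊎⊤ {n} = mk↔ₛ′ to from to∘from from∘to
  where
  to : YPart (Star (suc n)) (suc n) → SubsetsWith Odd (suc n) ⊎ ⊤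
  to ((true  ∷ _ , _) , _)       = inj₂ tt
  to ((false ∷ T , _) , [ odd ]) = inj₁ (T , [ odd ])

  from : SubsetsWith Odd (suc n) ⊎ ⊤ → YPart (Star (suc n)) (suc n)
  from (inj₁ (T , [ odd ])) = leaf-vertex T , [ odd ]
  from (inj₂ tt)            = centre-vertex , [ subst Odd (sym (∣⁅x⁆∣≡1 {suc (suc n)} zero)) odd-one ]

  to∘from : ∀ B → to (from B) ≡ B
  to∘from (inj₁ _) = refl
  to∘from (inj₂ _) = refl

  from∘to : ∀ A → from (to A) ≡ A
  from∘to ((true  ∷ T , [ independent∧small ]) , _) =
    Σ-irrelevant-≡ (Σ-irrelevant-≡ (cong (true ∷_) (sym (recompute (≡-dec Bool._≟_ T ⊥)
      (independent-with-centre (proj₁ independent∧small))))))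
  from∘to ((false ∷ T , _) , _) = refl

x∉p⇒∣p∪⁅x⁆∣≡1+∣p∣ : (p : Subset n) (x : Fin n) → x ∉ p → ∣ p ∪ ⁅ x ⁆ ∣ ≡ suc ∣ p ∣
x∉p⇒∣p∪⁅x⁆∣≡1+∣p∣ (true  ∷ p) zero    x∉p = ⊥-elim (x∉p here)
x∉p⇒∣p∪⁅x⁆∣≡1+∣p∣ (false ∷ p) zero    _   = cong (λ q → suc ∣ q ∣) (∪-identityʳ p)
x∉p⇒∣p∪⁅x⁆∣≡1+∣p∣ (true  ∷ p) (suc x) x∉p = cong suc (x∉p⇒∣p∪⁅x⁆∣≡1+∣p∣ p x (λ x∈p → x∉p (there x∈p)))
x∉p⇒∣p∪⁅x⁆∣≡1+∣p∣ (false ∷ p) (suc x) x∉p = x∉p⇒∣p∪⁅x⁆∣≡1+∣p∣ p x (λ x∈p → x∉p (there x∈p))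

AddsOne⇒∣T∣≡1+∣S∣ : {S T : Subset n} → AddsOne S T → ∣ T ∣ ≡ suc ∣ S ∣
AddsOne⇒∣T∣≡1+∣S∣ {S = S} (v , v∉S , refl) = x∉p⇒∣p∪⁅x⁆∣≡1+∣p∣ S v v∉S

parity-flips : ∀ n → (Even n × Odd (suc n)) ⊎ (Odd n × Even (suc n))
parity-flips n with even-or-odd n
... | inj₁ even-n = inj₁ (even-n , even⇒odd-suc even-n)
... | inj₂ odd-n  = inj₂ (odd-n , odd⇒even-suc odd-n)

I-bipartite-by-parity : (G : SimpleGraph m) (k : ℕ) →
  BipartiteWithParts (IAdj G k) (λ A → Even ∣ proj₁ A ∣) (λ A → Odd ∣ proj₁ A ∣)
I-bipartite-by-parity G k = (λ A → even-or-odd ∣ proj₁ A ∣) , (λ _ even odd → odd even) , edge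
  where
  edge : ∀ A B → IAdj G k A B →
         (Even ∣ proj₁ A ∣ × Odd ∣ proj₁ B ∣) ⊎ (Odd ∣ proj₁ A ∣ × Even ∣ proj₁ B ∣)
  edge A B (inj₁ A+v≡B) rewrite AddsOne⇒∣T∣≡1+∣S∣ A+v≡B = parity-flips ∣ proj₁ A ∣
  edge A B (inj₂ B+v≡A) = swap (⊎-map ×-swap ×-swap (edge B A (inj₁ B+v≡A)))

inject₁-inject₁≢suc-suc : (i : Fin n) → inject₁ (inject₁ i) ≢ suc (suc i)
inject₁-inject₁≢suc-suc zero    ()
inject₁-inject₁≢suc-suc (suc i) eq = inject₁-inject₁≢suc-suc i (suc-injective eq)

cycle-neighbours : ∀ {L} (R : Fin (3 + L) → Fin (3 + L) → Set) →
  (∀ j → R (inject₁ j) (suc j)) → R (fromℕ (2 + L)) zero →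
  ∀ i → ∃₂ λ p s → p ≢ s × R p i × R i s
cycle-neighbours R step close zero    = fromℕ _ , suc zero , (λ ()) , close , step zero
cycle-neighbours R step close (suc j) with view j
... | ‵fromℕ     = inject₁ (fromℕ _) , zero , (λ ()) , step (fromℕ _) , close
... | ‵inject₁ i =
  inject₁ (inject₁ i) , suc (suc i) , inject₁-inject₁≢suc-suc i , step (inject₁ i) , step (suc i)

hamiltonian⇒distinct-neighbours : {V : Set} {E : V → V → Set} → Hamiltonian E →
  ∀ v → ∃₂ λ u w → u ≢ w × E u v × E v w
hamiltonian⇒distinct-neighbours {E = E}
  (suc (suc L) , s≤s (s≤s _) , f , (f-injective , f-surjective) , step , close) v
  with f-surjective v
... | i , f≡v with cycle-neighbours (λ p q → E (f p) (f q)) step close i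
... | p , s , p≢s , fp~fi , fi~fs =
  f p , f s , (λ fp≡fs → p≢s (f-injective fp≡fs)) ,
  subst (E (f p)) (f≡v refl) fp~fi , subst (λ x → E x (f s)) (f≡v refl) fi~fs

centre-neighbour-empty : (B : IVertex (Star n) (suc k)) →
  IAdj (Star n) (suc k) centre-vertex B → proj₁ B ≡ ⊥
centre-neighbour-empty (_ , [ independent∧small ]) (inj₁ centre+v≡B) =
  ⊥-elim-irr (centre-not-extendable (proj₁ independent∧small) centre+v≡B)
centre-neighbour-empty _ (inj₂ B+v≡centre) = removal-from-singleton {x = zero} B+v≡centre

I-star-not-hamiltonian : ¬ Hamiltonian (IAdj (Star n) (suc k))
I-star-not-hamiltonian {n} {k} hamiltonian
  with hamiltonian⇒distinct-neighbours {E = IAdj (Star n) (suc k)} hamiltonian centre-vertex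
... | u , w , u≢w , u~centre , centre~w = u≢w (Σ-irrelevant-≡
  (trans (centre-neighbour-empty u (swap u~centre)) (sym (centre-neighbour-empty w centre~w))))

theorem2p2 : ∀ (n : ℕ) → 1 ≤ n →
    (BipartiteWithParts (IAdj (Star n) n)
        (λ A → Even ∣ proj₁ A ∣) (λ A → Odd ∣ proj₁ A ∣)
      × (XPart (Star n) n ↔ Fin (2 ^ (n ∸ 1)))
      × (YPart (Star n) n ↔ Fin (2 ^ (n ∸ 1) + 1)))
    × ¬ Hamiltonian (IAdj (Star n) n)
theorem2p2 (suc n) (s≤s z≤n) =
  ( I-bipartite-by-parity (Star (suc n)) (suc n)
  , ↔-trans XPart↔even-leaf-sets even-leaf-sets↔Fin
  , ↔-trans YPart↔odd-leaf-sets⊎⊤ (↔-trans (odd-leaf-sets↔Fin ⊎-↔ ↔-sym 1↔⊤) (↔-sym +↔⊎)) )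
  , I-star-not-hamiltonian
  where
  even-leaf-sets↔Fin : SubsetsWith Even (suc n) ↔ Fin (2 ^ n)
  even-leaf-sets↔Fin = ↔-trans (SubsetsWith-suc↔Subset even-alternating) Subset↔Fin2^

  odd-leaf-sets↔Fin : SubsetsWith Odd (suc n) ↔ Fin (2 ^ n)
  odd-leaf-sets↔Fin = ↔-trans (SubsetsWith-suc↔Subset odd-alternating) Subset↔Fin2^
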